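{- Let $n\ge 3$, let $x\in\mathbb{C}$, and let $A$ be the $n\times n$ tridiagonal matrix with $A_{ii}=x$ for all $i$, $A_{i,i+1}=A_{i+1,i}=\mathbf{i}$ for $1\le i\le n-1$, except that $A_{1,2}=2\mathbf{i}$ and $A_{n-1,n}=2\mathbf{i}$, all other entries $0$, where $\mathbf{i}=\sqrt{ -1}$. Then $$\det(A)=(x^2+4)F_{n-1}(x).$$
   Context: The Fibonacci polynomials are defined by $F_0(x)=0$, $F_1(x)=1$ and $F_n(x)=xF_{n-1}(x)+F_{n-2}(x)$ for $n\ge 2$. -}

module Defs where

open import Level using (Level)
open import Algebra.Bundles using (CommutativeRing)
open import Data.Nat as ℕ using (ℕ; zero; suc)
open import Data.Fin as Fin using (Fin; zero; suc; toℕ; punchIn)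
open import Data.Bool using (Bool; if_then_else_; _∨_)
open import Relation.Nullary.Decidable using (⌊_⌋)

module _ {c ℓ : Level} (R : CommutativeRing c ℓ) where
  open CommutativeRing R using (Carrier; _+_; _*_; -_; 0#; 1#)

  fibPoly : Carrier → ℕ → Carrier
  fibPoly x zero = 0#
  fibPoly x (suc zero) = 1#
  fibPoly x (suc (suc n)) = x * fibPoly x (suc n) + fibPoly x n

  ∑ : ∀ {n} → (Fin n → Carrier) → Carrier
  ∑ {zero} f = 0#
  ∑ {suc n} f = f zero + ∑ (λ j → f (suc j))

  sgn : ℕ → Carrier
  sgn zero = 1#
  sgn (suc k) = - sgn k

  det : ∀ {n} → (Fin n → Fin n → Carrier) → Carrier
  det {zero} M = 1#
  det {suc n} M =
    ∑ (λ j → sgn (toℕ j) * (M zero j * det (λ r s → M (suc r) (punchIn j s))))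

  four : Carrier
  four = 1# + 1# + 1# + 1#

  -- The n×n tridiagonal matrix of the theorem (indices 0-based here):
  -- diagonal entries x; super/sub-diagonal entries ι (= √-1), except the
  -- super-diagonal entries in positions (1,2) and (n-1,n) (1-based), which are 2ι.
  matA : Carrier → Carrier → (n : ℕ) → Fin n → Fin n → Carrier
  matA ι x n r s =
    if ⌊ toℕ r ℕ.≟ toℕ s ⌋ then x
    else if ⌊ suc (toℕ r) ℕ.≟ toℕ s ⌋ then
      (if ⌊ toℕ r ℕ.≟ 0 ⌋ ∨ ⌊ suc (suc (toℕ r)) ℕ.≟ n ⌋ then ι + ι else ι)
    else if ⌊ toℕ r ℕ.≟ suc (toℕ s) ⌋ then ι
    else 0#

-- The determinant of the tridiagonal matrix A of the theorem is computed by
-- the continuant recurrence for tridiagonal determinants.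
--
-- 1. General facts about the first-row Laplace expansion 'det': it respects
--    entrywise equality, a first column vanishing below the corner gives
--    det M = M₀₀ · det M₀₀-minor, and hence a matrix whose first row and
--    column vanish beyond the second entry satisfies the two-term expansion
--    det M = M₀₀ · det M' − M₀₁ M₁₀ · det M''  (M', M'' the trailing minors).
-- 2. For the tridiagonal matrix with diagonal d, superdiagonal b and
--    subdiagonal e, the trailing minors are again tridiagonal (with shifted
--    sequences), giving the continuant recurrence.
-- 3. With constant diagonal x and off-diagonal products bᵢeᵢ = −1 except the
--    last one equal to −2, the determinants are the Lucas polynomials L_k
--    (L₀ = 2, L₁ = x, L_{k+2} = x L_{k+1} + L_k).
-- 4. A is such a matrix, except that its first product is −2 as well, so one
--    more step of the recurrence gives det A = x L_{n-1} + 2 L_{n-2}, and this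
--    equals (x² + 4) F_{n-1} by induction on n.
module Submission where

open import Defs
open import Level using (Level)
open import Algebra.Bundles using (CommutativeRing)
open import Data.Nat as ℕ using (ℕ; zero; suc; _≤_; _<_; _∸_; _≟_; z≤n; s≤s)
open import Data.Nat.Properties using (suc-injective; ≟-diag; <⇒≢)
open import Data.Fin using (Fin; zero; suc; toℕ; punchIn)
open import Data.Bool using (if_then_else_; _∨_)
open import Data.Product using (_×_; _,_; proj₁; proj₂)
open import Function.Bundles using (mk⇔)
open import Relation.Nullary.Decidable using (⌊_⌋; isYes≗does; does-⇔; dec-no)
open import Relation.Binary.PropositionalEquality as ≡ using (_≡_)

-- Comparing successors decides the same way as comparing the numbers; this is
-- what lets tridiagonal matrices be shifted along the diagonal.
⌊suc≟suc⌋ : ∀ a b → ⌊ suc a ≟ suc b ⌋ ≡ ⌊ a ≟ b ⌋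
⌊suc≟suc⌋ a b = ≡.trans (isYes≗does (suc a ≟ suc b))
  (≡.trans (does-⇔ (mk⇔ suc-injective (≡.cong suc)) (suc a ≟ suc b) (a ≟ b))
           (≡.sym (isYes≗does (a ≟ b))))

module Continuants {c ℓ : Level} (R : CommutativeRing c ℓ) where
  open CommutativeRing R hiding (zero)
  open import Algebra.Properties.Ring ring using (-‿involutive; -1*x≈-x; -‿distribˡ-*; -‿+-comm)
  open import Algebra.Solver.Ring.NaturalCoefficients.Default commutativeSemiring
  open import Relation.Binary.Reasoning.Setoid setoid

  Matrix : ℕ → Set c
  Matrix n = Fin n → Fin n → Carrier

  minor : ∀ {n} → Matrix (suc n) → Fin (suc n) → Matrix n
  minor M j r s = M (suc r) (punchIn j s)

  cofactorTerm : ∀ {n} → Matrix (suc n) → Fin (suc n) → Carrier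
  cofactorTerm M j = sgn R (toℕ j) * (M zero j * det R (minor M j))

  ∑-cong : ∀ {n} {f g : Fin n → Carrier} → (∀ j → f j ≈ g j) → ∑ R f ≈ ∑ R g
  ∑-cong {zero} h = refl
  ∑-cong {suc n} h = +-cong (h zero) (∑-cong (λ j → h (suc j)))

  ∑-zero : ∀ {n} {f : Fin n → Carrier} → (∀ j → f j ≈ 0#) → ∑ R f ≈ 0#
  ∑-zero {zero} h = refl
  ∑-zero {suc n} h = trans (+-cong (h zero) (∑-zero (λ j → h (suc j)))) (+-identityʳ 0#)

  det-cong : ∀ {n} {M N : Matrix n} → (∀ r s → M r s ≈ N r s) → det R M ≈ det R N
  det-cong {zero} h = refl
  det-cong {suc n} h =
    ∑-cong (λ j → *-cong (refl {x = sgn R (toℕ j)}) (*-cong (h zero j) (det-cong (λ r s → h (suc r) (punchIn j s)))))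

  det-1×1 : (M : Matrix 1) → det R M ≈ M zero zero
  det-1×1 M = solve 1 (λ a → con 1 :* (a :* con 1) :+ con 0 := a) refl (M zero zero)

  term-zero-entry : ∀ {n} (M : Matrix (suc n)) j → M zero j ≈ 0# → cofactorTerm M j ≈ 0#
  term-zero-entry M j a≈0 = trans (*-congˡ (trans (*-congʳ a≈0) (zeroˡ _))) (zeroʳ _)

  term-zero-det : ∀ {n} (M : Matrix (suc n)) j → det R (minor M j) ≈ 0# → cofactorTerm M j ≈ 0#
  term-zero-det M j d≈0 = trans (*-congˡ (trans (*-congˡ d≈0) (zeroʳ _))) (zeroʳ _)

  -- If the first column vanishes below the corner, only the first term of the
  -- expansion survives: every other minor has a first column that is
  -- entirely zero, and so (by the same fact, one size smaller) determinant 0.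
  mutual
    laterTerms-vanish : ∀ {n} (M : Matrix (suc n)) → (∀ r → M (suc r) zero ≈ 0#) →
      ∑ R (λ j → cofactorTerm M (suc j)) ≈ 0#
    laterTerms-vanish {zero} M h = refl
    laterTerms-vanish {suc n} M h = ∑-zero λ j →
      term-zero-det M (suc j) (trans (expandFirstColumn (minor M (suc j)) (λ r → h (suc r)))
                                 (trans (*-congʳ (h zero)) (zeroˡ _)))

    expandFirstColumn : ∀ {n} (M : Matrix (suc n)) → (∀ r → M (suc r) zero ≈ 0#) →
      det R M ≈ M zero zero * det R (minor M zero)
    expandFirstColumn M h =
      trans (+-cong (*-identityˡ _) (laterTerms-vanish M h)) (+-identityʳ _)

  expandTwoByTwo : ∀ {m} (M : Matrix (suc (suc m))) →
    (∀ j → M zero (suc (suc j)) ≈ 0#) → (∀ r → M (suc (suc r)) zero ≈ 0#) →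
    det R M ≈ M zero zero * det R (λ r s → M (suc r) (suc s))
              + - (M zero (suc zero) * M (suc zero) zero)
                * det R (λ r s → M (suc (suc r)) (suc (suc s)))
  expandTwoByTwo M row col = begin
      1# * (a * D₁) + (- 1# * (b * det R (minor M (suc zero))) + rest)
    ≈⟨ +-cong (*-identityˡ _) (trans (+-congˡ restVanishes) (+-identityʳ _)) ⟩
      a * D₁ + - 1# * (b * det R (minor M (suc zero)))
    ≈⟨ +-congˡ (trans (-1*x≈-x _) (-‿cong (*-congˡ secondMinor))) ⟩
      a * D₁ + - (b * (e * D₂))
    ≈⟨ +-congˡ (trans (-‿cong (sym (*-assoc b e D₂))) (-‿distribˡ-* (b * e) D₂)) ⟩
      a * D₁ + - (b * e) * D₂ ∎
    where
    a = M zero zero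
    b = M zero (suc zero)
    e = M (suc zero) zero
    D₁ = det R (λ r s → M (suc r) (suc s))
    D₂ = det R (λ r s → M (suc (suc r)) (suc (suc s)))
    rest = ∑ R (λ j → cofactorTerm M (suc (suc j)))
    restVanishes : rest ≈ 0#
    restVanishes = ∑-zero (λ j → term-zero-entry M (suc (suc j)) (row j))
    -- deleting column 1 leaves a minor whose first column is (e, 0, …, 0)
    secondMinor : det R (minor M (suc zero)) ≈ e * D₂
    secondMinor = expandFirstColumn (minor M (suc zero)) col

  shift : (ℕ → Carrier) → ℕ → Carrier
  shift f i = f (suc i)

  tridiag : (d b e : ℕ → Carrier) → (m : ℕ) → Matrix m
  tridiag d b e m r s =
    if ⌊ toℕ r ≟ toℕ s ⌋ then d (toℕ r)
    else if ⌊ suc (toℕ r) ≟ toℕ s ⌋ then b (toℕ r)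
    else if ⌊ toℕ r ≟ suc (toℕ s) ⌋ then e (toℕ s)
    else 0#

  tridiag-shift : ∀ d b e m r s →
    tridiag d b e (suc m) (suc r) (suc s) ≡ tridiag (shift d) (shift b) (shift e) m r s
  tridiag-shift d b e m r s
    rewrite ⌊suc≟suc⌋ (toℕ r) (toℕ s) | ⌊suc≟suc⌋ (suc (toℕ r)) (toℕ s)
          | ⌊suc≟suc⌋ (toℕ r) (suc (toℕ s)) = ≡.refl

  tridiag-rec : ∀ d b e m →
    det R (tridiag d b e (suc (suc m)))
      ≈ d 0 * det R (tridiag (shift d) (shift b) (shift e) (suc m))
        + - (b 0 * e 0) * det R (tridiag (shift (shift d)) (shift (shift b)) (shift (shift e)) m)
  tridiag-rec d b e m =
    trans (expandTwoByTwo (tridiag d b e (suc (suc m))) (λ _ → refl) (λ _ → refl))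
      (+-cong (*-congˡ (det-cong λ r s → reflexive (tridiag-shift d b e (suc m) r s)))
              (*-congˡ (det-cong λ r s → reflexive
                (≡.trans (tridiag-shift d b e (suc m) (suc r) (suc s))
                         (tridiag-shift (shift d) (shift b) (shift e) m r s)))))

  negate : ∀ {p q} → p ≈ - q → - p ≈ q
  negate {p} {q} h = trans (-‿cong h) (-‿involutive q)

  module _ (x : Carrier) where

    lucasPoly : ℕ → Carrier
    lucasPoly 0 = 1# + 1#
    lucasPoly 1 = x
    lucasPoly (suc (suc k)) = x * lucasPoly (suc k) + lucasPoly k

    tridiag-lucas : ∀ j b e → (∀ i → i < j → b i * e i ≈ - 1#) → b j * e j ≈ - (1# + 1#) →
      det R (tridiag (λ _ → x) b e (suc (suc j))) ≈ lucasPoly (suc (suc j))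
      × det R (tridiag (λ _ → x) (shift b) (shift e) (suc j)) ≈ lucasPoly (suc j)
    tridiag-lucas zero b e inner last = (begin
        det R (tridiag (λ _ → x) b e 2)
      ≈⟨ tridiag-rec (λ _ → x) b e 0 ⟩
        x * det R (tridiag (λ _ → x) (shift b) (shift e) 1) + - (b 0 * e 0) * 1#
      ≈⟨ +-cong (*-congˡ minor≈x) (trans (*-identityʳ _) (negate last)) ⟩
        lucasPoly 2 ∎) , minor≈x
      where
      minor≈x : det R (tridiag (λ _ → x) (shift b) (shift e) 1) ≈ x
      minor≈x = det-1×1 (tridiag (λ _ → x) (shift b) (shift e) 1)
    tridiag-lucas (suc j) b e inner last = (begin
        det R (tridiag (λ _ → x) b e (3 ℕ.+ j))
      ≈⟨ tridiag-rec (λ _ → x) b e (suc j) ⟩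
        x * det R (tridiag (λ _ → x) (shift b) (shift e) (2 ℕ.+ j))
          + - (b 0 * e 0) * det R (tridiag (λ _ → x) (shift (shift b)) (shift (shift e)) (suc j))
      ≈⟨ +-cong (*-congˡ (proj₁ ih)) (*-cong (negate (inner 0 (s≤s z≤n))) (proj₂ ih)) ⟩
        x * lucasPoly (2 ℕ.+ j) + 1# * lucasPoly (suc j)
      ≈⟨ +-congˡ (*-identityˡ _) ⟩
        lucasPoly (3 ℕ.+ j) ∎) , proj₁ ih
      where
      ih = tridiag-lucas j (shift b) (shift e) (λ i i<j → inner (suc i) (s≤s i<j)) last

    -- x L_{j+2} + 2 L_{j+1} = (x² + 4) F_{j+2}: both sides satisfy the
    -- Fibonacci recurrence in j, so it suffices to check j = 0, 1.
    lucas-fib : ∀ j → x * lucasPoly (suc (suc j)) + (1# + 1#) * lucasPoly (suc j)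
                        ≈ (x * x + four R) * fibPoly R x (suc (suc j))
    lucas-fib zero = solve 1 (λ x →
        x :* (x :* x :+ (con 1 :+ con 1)) :+ (con 1 :+ con 1) :* x
      := (x :* x :+ (((con 1 :+ con 1) :+ con 1) :+ con 1)) :* (x :* con 1 :+ con 0)) refl x
    lucas-fib (suc zero) = solve 1 (λ x →
        x :* (x :* (x :* x :+ (con 1 :+ con 1)) :+ x) :+ (con 1 :+ con 1) :* (x :* x :+ (con 1 :+ con 1))
      := (x :* x :+ (((con 1 :+ con 1) :+ con 1) :+ con 1)) :* (x :* (x :* con 1 :+ con 0) :+ con 1)) refl x
    lucas-fib (suc (suc j)) = begin
        x * (x * L₃ + L₂) + two * (x * L₂ + L₁)
      ≈⟨ solve 5 (λ x L₃ L₂ L₁ two → x :* (x :* L₃ :+ L₂) :+ two :* (x :* L₂ :+ L₁)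
                                    := x :* (x :* L₃ :+ two :* L₂) :+ (x :* L₂ :+ two :* L₁))
               refl x L₃ L₂ L₁ two ⟩
        x * (x * L₃ + two * L₂) + (x * L₂ + two * L₁)
      ≈⟨ +-cong (*-congˡ (lucas-fib (suc j))) (lucas-fib j) ⟩
        x * (k * F₃) + k * F₂
      ≈⟨ solve 4 (λ x k F₃ F₂ → x :* (k :* F₃) :+ k :* F₂ := k :* (x :* F₃ :+ F₂)) refl x k F₃ F₂ ⟩
        k * fibPoly R x (4 ℕ.+ j) ∎
      where
      L₃ = lucasPoly (3 ℕ.+ j)
      L₂ = lucasPoly (2 ℕ.+ j)
      L₁ = lucasPoly (1 ℕ.+ j)
      F₃ = fibPoly R x (3 ℕ.+ j)
      F₂ = fibPoly R x (2 ℕ.+ j)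
      two = 1# + 1#
      k = x * x + four R

  doubled-product : ∀ ι → ι * ι ≈ - 1# → (ι + ι) * ι ≈ - (1# + 1#)
  doubled-product ι ι²≈-1 = trans (distribʳ ι ι ι) (trans (+-cong ι²≈-1 ι²≈-1) (-‿+-comm 1# 1#))

-- matA is, by definition, tridiag with diagonal x, subdiagonal ι and
-- superdiagonal βᵢ = 2ι at the first and last positions, ι elsewhere.
theorem12 : ∀ {c ℓ : Level} (R : CommutativeRing c ℓ) →
    let open CommutativeRing R in
    (ι : Carrier) → ι * ι ≈ - 1# →
    (n : ℕ) → 3 ≤ n → (x : Carrier) →
    det R (matA R ι x n) ≈ (x * x + four R) * fibPoly R x (n ∸ 1)
theorem12 R ι ι²≈-1 n@(suc (suc (suc j))) (s≤s (s≤s (s≤s z≤n))) x = begin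
    det R (tridiag (λ _ → x) β (λ _ → ι) n)
  ≈⟨ tridiag-rec (λ _ → x) β (λ _ → ι) (suc j) ⟩
    x * det R (tridiag (λ _ → x) (shift β) (λ _ → ι) (2 ℕ.+ j))
      + - ((ι + ι) * ι) * det R (tridiag (λ _ → x) (shift (shift β)) (λ _ → ι) (suc j))
  ≈⟨ +-cong (*-congˡ (proj₁ lucas)) (*-cong (negate (doubled-product ι ι²≈-1)) (proj₂ lucas)) ⟩
    x * lucasPoly x (2 ℕ.+ j) + (1# + 1#) * lucasPoly x (suc j)
  ≈⟨ lucas-fib x j ⟩
    (x * x + four R) * fibPoly R x (suc (suc j)) ∎
  where
  open CommutativeRing R
  open Continuants R
  open import Relation.Binary.Reasoning.Setoid setoid
  β : ℕ → Carrier
  β i = if ⌊ i ≟ 0 ⌋ ∨ ⌊ suc (suc i) ≟ n ⌋ then ι + ι else ι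
  inner : ∀ i → i < j → shift β i * ι ≈ - 1#
  inner i i<j rewrite dec-no (3 ℕ.+ i ≟ n) (λ eq → <⇒≢ i<j (≡.cong (_∸ 3) eq)) = ι²≈-1
  last : shift β j * ι ≈ - (1# + 1#)
  last rewrite ≟-diag {n} ≡.refl = doubled-product ι ι²≈-1
  lucas : det R (tridiag (λ _ → x) (shift β) (λ _ → ι) (2 ℕ.+ j)) ≈ lucasPoly x (2 ℕ.+ j)
          × det R (tridiag (λ _ → x) (shift (shift β)) (λ _ → ι) (suc j)) ≈ lucasPoly x (suc j)
  lucas = tridiag-lucas x j (shift β) (λ _ → ι) inner last
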